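{- For all $n\geq 1$, $$G_{2n+2}(q)=\sum_{\sigma\in \mathcal{F}_{2n+1}}q^{\frac12(\mathrm{inv}\,\sigma-n)},$$ equivalently $G_{2n+2}(q^2)$ is the generating function of $\mathcal{F}_{2n+1}$ with respect to $\mathrm{inv}\,\sigma-n$.
   Context: The $q$-Seidel triangle $(g_{i,j}(q))_{i,j\geq 1}$ is defined by $g_{1,1}(q)=g_{2,1}(q)=1$, $g_{i,j}(q)=0$ if $j<0$ or $j>\lceil i/2\rceil$, and for $i\geq 1$: $g_{2i+1,j}(q)=g_{2i+1,j-1}(q)+q^{j-1}g_{2i,j}(q)$ for $j=1,\ldots,i+1$ (in this order), and $g_{2i,j}(q)=g_{2i,j+1}(q)+q^{j-1}g_{2i-1,j}(q)$ for $j=i,i-1,\ldots,1$ (in this order). The $q$-Genocchi numbers are $G_2(q)=1$ and $G_{2n}(q)=g_{2n-1,n}(q)$ for $n\geq 2$. For a permutation $\sigma$ of $[N]$, its inversion table is $f_\sigma:[N]\to[0,N-1]$, $f_\sigma(i)=\#\{j<i:\sigma(j)<\sigma(i)\}$; $\mathrm{inv}\,\sigma$ is the number of inversions of $\sigma$ (so $\mathrm{inv}\,\sigma=\frac{N(N-1)}{2}-\sum_i f_\sigma(i)$). A permutation $\sigma$ of $[2n+1]$ is alternating if $\sigma(2i-1)>\sigma(2i)<\sigma(2i+1)$ for all $i\in[n]$. $\mathcal{F}_{2n+1}$ is the set of alternating permutations of $[2n+1]$ whose inversion table takes only even values. -}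

module Defs where

open import Data.Nat using (ℕ; zero; suc; _+_; _*_; _∸_; _<ᵇ_; _≡ᵇ_)
open import Data.Nat.DivMod using (_/_; _%_)
open import Data.Bool using (Bool; true; false; _∧_; _∨_; not; if_then_else_)
open import Data.List using (List; []; _∷_; _++_; replicate; map; foldr; filterᵇ; length; upTo; concatMap)

-- Polynomials in q with natural-number coefficients, as coefficient
-- lists (constant term first).  Equality is coefficientwise (coeff).

Poly : Set
Poly = List ℕ

infixl 6 _⊕_
_⊕_ : Poly → Poly → Poly
[] ⊕ q = q
(a ∷ p) ⊕ [] = a ∷ p
(a ∷ p) ⊕ (b ∷ q) = (a + b) ∷ (p ⊕ q)

0P : Poly
0P = []

1P : Poly
1P = 1 ∷ []

shift : ℕ → Poly → Poly
shift k p = replicate k 0 ++ p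

mono : ℕ → Poly
mono k = shift k 1P

coeff : Poly → ℕ → ℕ
coeff [] k = 0
coeff (a ∷ p) zero = a
coeff (a ∷ p) (suc k) = coeff p k

sq : Poly → Poly
sq [] = []
sq (a ∷ p) = a ∷ 0 ∷ sq p

-- The q-Seidel triangle.  A row is a function j ↦ g_{r,j} (j = 0 and
-- out-of-range j give 0).

Row : Set
Row = ℕ → Poly

-- row 2i+1 from row 2i:  g_{2i+1,j} = g_{2i+1,j-1} + q^{j-1} g_{2i,j}, j = 1..i+1
oddAux : Row → ℕ → Poly
oddAux e zero = 0P
oddAux e (suc j) = oddAux e j ⊕ shift j (e (suc j))

oddStep : ℕ → Row → Row
oddStep i e zero = 0P
oddStep i e (suc j) = if j <ᵇ suc i then oddAux e (suc j) else 0P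

-- row 2i from row 2i-1:  g_{2i,j} = g_{2i,j+1} + q^{j-1} g_{2i-1,j}, j = i..1,
-- starting from g_{2i,i+1} = 0.  evenAux i o t = g_{2i, i+1-t}.
evenAux : ℕ → Row → ℕ → Poly
evenAux i o zero = 0P
evenAux i o (suc t) = evenAux i o t ⊕ shift (i ∸ t ∸ 1) (o (i ∸ t))

evenStep : ℕ → Row → Row
evenStep i o zero = 0P
evenStep i o (suc j) = if j <ᵇ i then evenAux i o (suc i ∸ suc j) else 0P

baseRow : Row
baseRow zero = 0P
baseRow (suc zero) = 1P
baseRow (suc (suc j)) = 0P

-- oddRow i = row 2i+1, evenRow i = row 2i
oddRow : ℕ → Row
evenRow : ℕ → Row
oddRow zero = baseRow
oddRow (suc i) = oddStep (suc i) (evenRow (suc i))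
evenRow zero = λ _ → 0P                                 -- row 0 (unused)
evenRow (suc zero) = baseRow
evenRow (suc (suc i)) = evenStep (suc (suc i)) (oddRow (suc i))

g : ℕ → ℕ → Poly
g r = if r % 2 ≡ᵇ 0 then evenRow (r / 2) else oddRow (r / 2)

-- qGenocchi n = G_{2n}(q)  (n ≥ 1; value at n = 0 is a dummy 0)
qGenocchi : ℕ → Poly
qGenocchi zero = 0P
qGenocchi (suc zero) = 1P
qGenocchi (suc (suc m)) = g (2 * suc (suc m) ∸ 1) (suc (suc m))

-- Permutations of [N] as words σ(1) σ(2) … σ(N) (List ℕ).

words : ℕ → ℕ → List (List ℕ)
words zero N = [] ∷ []
words (suc m) N = concatMap (λ a → map (a ∷_) (words m N)) (map suc (upTo N))

memberᵇ : ℕ → List ℕ → Bool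
memberᵇ x [] = false
memberᵇ x (y ∷ ys) = (x ≡ᵇ y) ∨ memberᵇ x ys

distinctᵇ : List ℕ → Bool
distinctᵇ [] = true
distinctᵇ (x ∷ xs) = not (memberᵇ x xs) ∧ distinctᵇ xs

allᵇ : (ℕ → Bool) → List ℕ → Bool
allᵇ p [] = true
allᵇ p (x ∷ xs) = p x ∧ allᵇ p xs

isPermᵇ : ℕ → List ℕ → Bool
isPermᵇ N σ = (length σ ≡ᵇ N) ∧ allᵇ (λ x → (0 <ᵇ x) ∧ (x <ᵇ suc N)) σ ∧ distinctᵇ σ

countᵇ : (ℕ → Bool) → List ℕ → ℕ
countᵇ p xs = length (filterᵇ p xs)

invTableAux : List ℕ → List ℕ → List ℕ
invTableAux pre [] = []
invTableAux pre (x ∷ xs) = countᵇ (_<ᵇ x) pre ∷ invTableAux (pre ++ (x ∷ [])) xs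

invTable : List ℕ → List ℕ
invTable σ = invTableAux [] σ

invAux : List ℕ → List ℕ → ℕ
invAux pre [] = 0
invAux pre (x ∷ xs) = countᵇ (x <ᵇ_) pre + invAux (pre ++ (x ∷ [])) xs

inv : List ℕ → ℕ
inv σ = invAux [] σ

alternatingᵇ : List ℕ → Bool
alternatingᵇ (a ∷ []) = true
alternatingᵇ (a ∷ b ∷ c ∷ rest) = (b <ᵇ a) ∧ (b <ᵇ c) ∧ alternatingᵇ (c ∷ rest)
alternatingᵇ _ = false

evenᵇ : ℕ → Bool
evenᵇ k = k % 2 ≡ᵇ 0

F : ℕ → List (List ℕ)
F n = filterᵇ (λ σ → isPermᵇ N σ ∧ alternatingᵇ σ ∧ allᵇ evenᵇ (invTable σ)) (words N N)
  where N = suc (2 * n)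

genF : ℕ → Poly
genF n = foldr _⊕_ 0P (map (λ σ → mono (inv σ ∸ n)) (F n))

{-# OPTIONS --safe #-}
module Submission where

-- Read a permutation σ of [N] through its inversion table f, stored backwards as a code
-- f(N) ∷ … ∷ f(1) with f(i) < i; decoding is a bijection onto the permutations, and
-- inv σ = Σ (i − 1 − f(i)).  On the table, σ(i) > σ(i+1) iff f(i+1) ≤ f(i), so 𝓕_{2n+1}
-- becomes the set of codes with even entries obeying alternating inequalities.  Sorting
-- such codes by their head f(N) = c and deleting it (weight q^{N−1−c}) reproduces the
-- recursion of the q-Seidel triangle at q²: by induction q^i g_{2i+1,j}(q²) counts the
-- codes of length 2i+1 with f(2i+1) ≥ 2(i+1−j), and q^{i+1} g_{2i+2,j}(q²) those of length
-- 2i+2 with f(2i+2) < 2(i+2−j), each by q^inv.  For j = n+1 this gives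
-- q^n G_{2n+2}(q²) = Σ_{σ ∈ 𝓕_{2n+1}} q^{inv σ}, and inv σ ≥ n there because
-- f(2i) + 2 ≤ f(2i+1) ≤ 2i, so the factor q^n can be cancelled.

open import Defs
import Algebra.Bundles
import Data.Bool.Properties
import Data.Nat.Properties
open import Algebra.Properties.CommutativeSemigroup Data.Nat.Properties.+-commutativeSemigroup using (interchange)
open import Algebra.Properties.CommutativeSemigroup (Algebra.Bundles.CommutativeMonoid.commutativeSemigroup Data.Bool.Properties.∧-commutativeMonoid) using () renaming (interchange to ∧-interchange)
open import Data.Bool using (Bool; true; false; _∧_; _∨_; not; if_then_else_; T)
open import Data.Bool.Properties using (∨-assoc; ∨-comm; ∧-assoc; ∧-comm; ∧-zeroʳ; ∧-identityʳ; not-involutive)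
open import Data.Empty using (⊥-elim)
open import Data.List using (List; []; _∷_; _++_; map; foldr; filterᵇ; length; upTo; concat; applyUpTo)
open import Data.List.Properties using (++-assoc; ++-identityʳ; length-++; length-map; map-++)
open import Data.Nat using (ℕ; zero; suc; _+_; _*_; _∸_; _≤_; _<_; z≤n; s≤s; _<ᵇ_; _≡ᵇ_; _≤ᵇ_; _≤?_; _<?_)
open import Data.Nat.DivMod using (_/_; _%_; m/n≡1+[m∸n]/n)
open import Data.Nat.Properties
open import Data.Product using (_×_; _,_)
open import Function using (_∘_; id)
open import Relation.Binary.Definitions using (tri<; tri≈; tri>)
open import Relation.Binary.PropositionalEquality
open import Relation.Nullary using (¬_; yes; no; Dec)

open ≡-Reasoning

T⇒≡true : ∀ {b} → T b → b ≡ true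
T⇒≡true {true} _ = refl

¬T⇒≡false : ∀ {b} → ¬ T b → b ≡ false
¬T⇒≡false {false} _ = refl
¬T⇒≡false {true}  ¬t = ⊥-elim (¬t _)

≡true⇒T : ∀ {b} → b ≡ true → T b
≡true⇒T refl = _

<ᵇ-true : ∀ {m n} → m < n → (m <ᵇ n) ≡ true
<ᵇ-true m<n = T⇒≡true (<⇒<ᵇ m<n)

<ᵇ-false : ∀ {m n} → n ≤ m → (m <ᵇ n) ≡ false
<ᵇ-false {m} {n} n≤m = ¬T⇒≡false (λ t → <⇒≱ (<ᵇ⇒< m n t) n≤m)

≤ᵇ-true : ∀ {m n} → m ≤ n → (m ≤ᵇ n) ≡ true
≤ᵇ-true m≤n = T⇒≡true (≤⇒≤ᵇ m≤n)

≤ᵇ-false : ∀ {m n} → n < m → (m ≤ᵇ n) ≡ false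
≤ᵇ-false {m} {n} n<m = ¬T⇒≡false (λ t → <⇒≱ n<m (≤ᵇ⇒≤ m n t))

≡ᵇ-refl : ∀ n → (n ≡ᵇ n) ≡ true
≡ᵇ-refl n = T⇒≡true (≡⇒≡ᵇ n n refl)

≡ᵇ-false : ∀ {m n} → m ≢ n → (m ≡ᵇ n) ≡ false
≡ᵇ-false {m} {n} m≢n = ¬T⇒≡false (m≢n ∘ ≡ᵇ⇒≡ m n)

≡ᵇ-sym : ∀ m n → (m ≡ᵇ n) ≡ (n ≡ᵇ m)
≡ᵇ-sym zero    zero    = refl
≡ᵇ-sym zero    (suc n) = refl
≡ᵇ-sym (suc m) zero    = refl
≡ᵇ-sym (suc m) (suc n) = ≡ᵇ-sym m n

≤ᵇ≡<ᵇ-suc : ∀ m n → (m ≤ᵇ n) ≡ (m <ᵇ suc n)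
≤ᵇ≡<ᵇ-suc zero    n = refl
≤ᵇ≡<ᵇ-suc (suc m) n = refl

𝟙 : Bool → ℕ
𝟙 true  = 1
𝟙 false = 0

double : ℕ → ℕ
double zero    = zero
double (suc n) = suc (suc (double n))

+-≡ᵇ-cancelˡ : ∀ n a b → (n + a ≡ᵇ n + b) ≡ (a ≡ᵇ b)
+-≡ᵇ-cancelˡ zero    a b = refl
+-≡ᵇ-cancelˡ (suc n) a b = +-≡ᵇ-cancelˡ n a b

+-≡ᵇ-split : ∀ x d k → 𝟙 (x + d ≡ᵇ k) ≡ (if d ≤ᵇ k then 𝟙 (x ≡ᵇ k ∸ d) else 0)
+-≡ᵇ-split x d k with d ≤? k
... | yes d≤k rewrite ≤ᵇ-true d≤k = cong 𝟙 (begin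
  (x + d ≡ᵇ k)           ≡⟨ cong₂ _≡ᵇ_ (+-comm x d) (sym (m+[n∸m]≡n d≤k)) ⟩
  (d + x ≡ᵇ d + (k ∸ d)) ≡⟨ +-≡ᵇ-cancelˡ d x (k ∸ d) ⟩
  (x ≡ᵇ k ∸ d)           ∎)
... | no d≰k rewrite ≤ᵇ-false (≰⇒> d≰k) =
  cong 𝟙 (≡ᵇ-false (λ eq → <⇒≢ (<-≤-trans (≰⇒> d≰k) (m≤n+m d x)) (sym eq)))

-- Finite sums

∑< : ℕ → (ℕ → ℕ) → ℕ
∑< zero    f = 0
∑< (suc n) f = ∑< n f + f n

syntax ∑< n (λ i → e) = ∑[ i < n ] e

∑<-cong : ∀ n {f g : ℕ → ℕ} → (∀ i → i < n → f i ≡ g i) → ∑< n f ≡ ∑< n g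
∑<-cong zero    eq = refl
∑<-cong (suc n) eq = cong₂ _+_ (∑<-cong n (λ i i<n → eq i (m<n⇒m<1+n i<n))) (eq n ≤-refl)

∑<-0 : ∀ n → ∑[ _ < n ] 0 ≡ 0
∑<-0 zero    = refl
∑<-0 (suc n) = trans (+-identityʳ _) (∑<-0 n)

∑<-+ : ∀ n (f g : ℕ → ℕ) → ∑[ i < n ] (f i + g i) ≡ ∑< n f + ∑< n g
∑<-+ zero    f g = refl
∑<-+ (suc n) f g = trans (cong (_+ (f n + g n)) (∑<-+ n f g)) (interchange (∑< n f) (∑< n g) (f n) (g n))

∑<-suc : ∀ n f → ∑< (suc n) f ≡ f 0 + ∑< n (f ∘ suc)
∑<-suc zero    f = +-comm 0 (f 0)
∑<-suc (suc n) f = trans (cong (_+ f (suc n)) (∑<-suc n f)) (+-assoc (f 0) _ _)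

∑<-reverse : ∀ n f → ∑< n f ≡ ∑[ t < n ] f (n ∸ suc t)
∑<-reverse zero    f = refl
∑<-reverse (suc n) f = begin
  ∑< (suc n) f                                ≡⟨ ∑<-suc n f ⟩
  f 0 + ∑< n (f ∘ suc)                        ≡⟨ cong (f 0 +_) (∑<-reverse n (f ∘ suc)) ⟩
  f 0 + ∑[ t < n ] f (suc (n ∸ suc t))         ≡⟨ cong (f 0 +_) (∑<-cong n (λ t t<n → cong f (sym (+-∸-assoc 1 t<n)))) ⟩
  f 0 + ∑[ t < n ] f (suc n ∸ suc t)           ≡⟨ +-comm (f 0) _ ⟩
  ∑[ t < n ] f (suc n ∸ suc t) + f 0           ≡⟨ cong (λ z → ∑[ t < n ] f (suc n ∸ suc t) + f z) (sym (n∸n≡0 n)) ⟩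
  ∑[ t < suc n ] f (suc n ∸ suc t)             ∎

∑<-restrict : ∀ {m} n (f : ℕ → ℕ) → m ≤ n → ∑[ t < n ] (if t <ᵇ m then f t else 0) ≡ ∑< m f
∑<-restrict zero    f z≤n = refl
∑<-restrict {m} (suc n) f m≤1+n with m ≤? n
... | yes m≤n rewrite <ᵇ-false m≤n = trans (+-identityʳ _) (∑<-restrict n f m≤n)
... | no m≰n rewrite ≤-antisym m≤1+n (≰⇒> m≰n) | <ᵇ-true (n<1+n n) =
  cong (_+ f n) (∑<-cong n (λ t t<n → cong (λ b → if b then f t else 0) (<ᵇ-true (m<n⇒m<1+n t<n))))

∑∈ : {A : Set} → List A → (A → ℕ) → ℕ
∑∈ []       f = 0
∑∈ (x ∷ xs) f = f x + ∑∈ xs f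

syntax ∑∈ xs (λ x → e) = ∑[ x ∈ xs ] e

module _ {A : Set} where

  ∑∈-cong : ∀ (xs : List A) {f g : A → ℕ} → (∀ x → f x ≡ g x) → ∑∈ xs f ≡ ∑∈ xs g
  ∑∈-cong []       eq = refl
  ∑∈-cong (x ∷ xs) eq = cong₂ _+_ (eq x) (∑∈-cong xs eq)

  ∑∈-0 : ∀ (xs : List A) → ∑[ _ ∈ xs ] 0 ≡ 0
  ∑∈-0 []       = refl
  ∑∈-0 (x ∷ xs) = ∑∈-0 xs

  ∑∈-++ : ∀ (xs ys : List A) f → ∑∈ (xs ++ ys) f ≡ ∑∈ xs f + ∑∈ ys f
  ∑∈-++ []       ys f = refl
  ∑∈-++ (x ∷ xs) ys f = trans (cong (f x +_) (∑∈-++ xs ys f)) (sym (+-assoc (f x) _ _))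

  ∑∈-concat : ∀ (xss : List (List A)) f → ∑∈ (concat xss) f ≡ ∑[ xs ∈ xss ] ∑∈ xs f
  ∑∈-concat []         f = refl
  ∑∈-concat (xs ∷ xss) f = trans (∑∈-++ xs (concat xss) f) (cong (∑∈ xs f +_) (∑∈-concat xss f))

  ∑∈-map : ∀ {B : Set} (g : B → A) (xs : List B) f → ∑∈ (map g xs) f ≡ ∑∈ xs (f ∘ g)
  ∑∈-map g []       f = refl
  ∑∈-map g (x ∷ xs) f = cong (f (g x) +_) (∑∈-map g xs f)

  ∑∈-filterᵇ : ∀ p (xs : List A) f → ∑∈ (filterᵇ p xs) f ≡ ∑[ x ∈ xs ] (if p x then f x else 0)
  ∑∈-filterᵇ p []       f = refl
  ∑∈-filterᵇ p (x ∷ xs) f with p x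
  ... | true  = cong (f x +_) (∑∈-filterᵇ p xs f)
  ... | false = ∑∈-filterᵇ p xs f

  ∑∈-∑<-comm : ∀ (xs : List A) n (f : A → ℕ → ℕ) → ∑[ x ∈ xs ] ∑< n (f x) ≡ ∑[ i < n ] ∑[ x ∈ xs ] f x i
  ∑∈-∑<-comm []       n f = sym (∑<-0 n)
  ∑∈-∑<-comm (x ∷ xs) n f = trans (cong (∑< n (f x) +_) (∑∈-∑<-comm xs n f)) (sym (∑<-+ n (f x) _))

∑∈-applyUpTo : ∀ (h : ℕ → ℕ) n f → ∑∈ (applyUpTo h n) f ≡ ∑< n (f ∘ h)
∑∈-applyUpTo h zero    f = refl
∑∈-applyUpTo h (suc n) f = trans (cong (f (h 0) +_) (∑∈-applyUpTo (h ∘ suc) n f)) (sym (∑<-suc n (f ∘ h)))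

-- Coefficients of shifted and squared polynomials

coeff-⊕ : ∀ p q k → coeff (p ⊕ q) k ≡ coeff p k + coeff q k
coeff-⊕ []      q       k       = refl
coeff-⊕ (a ∷ p) []      k       = sym (+-identityʳ _)
coeff-⊕ (a ∷ p) (b ∷ q) zero    = refl
coeff-⊕ (a ∷ p) (b ∷ q) (suc k) = coeff-⊕ p q k

coeff-∑⊕ : ∀ {A : Set} (f : A → Poly) xs k → coeff (foldr _⊕_ 0P (map f xs)) k ≡ ∑[ x ∈ xs ] coeff (f x) k
coeff-∑⊕ f []       k = refl
coeff-∑⊕ f (x ∷ xs) k = trans (coeff-⊕ (f x) _ k) (cong (coeff (f x) k +_) (coeff-∑⊕ f xs k))

coeff-mono : ∀ m k → coeff (mono m) k ≡ 𝟙 (m ≡ᵇ k)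
coeff-mono zero    zero    = refl
coeff-mono zero    (suc k) = refl
coeff-mono (suc m) zero    = refl
coeff-mono (suc m) (suc k) = coeff-mono m k

coeff-shift-+ : ∀ m n p k → coeff (shift (m + n) p) k ≡ (if m ≤ᵇ k then coeff (shift n p) (k ∸ m) else 0)
coeff-shift-+ zero    n p k       = refl
coeff-shift-+ (suc m) n p zero    = refl
coeff-shift-+ (suc m) n p (suc k) =
  trans (coeff-shift-+ m n p k) (cong (λ b → if b then coeff (shift n p) (k ∸ m) else 0) (≤ᵇ≡<ᵇ-suc m k))

coeff-shift-⊕ : ∀ n p q k → coeff (shift n (p ⊕ q)) k ≡ coeff (shift n p) k + coeff (shift n q) k
coeff-shift-⊕ zero    p q k       = coeff-⊕ p q k
coeff-shift-⊕ (suc n) p q zero    = refl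
coeff-shift-⊕ (suc n) p q (suc k) = coeff-shift-⊕ n p q k

coeff-shift-0P : ∀ n k → coeff (shift n 0P) k ≡ 0
coeff-shift-0P zero    k       = refl
coeff-shift-0P (suc n) zero    = refl
coeff-shift-0P (suc n) (suc k) = coeff-shift-0P n k

coeff-shift-+ˡ : ∀ n p k → coeff (shift n p) (n + k) ≡ coeff p k
coeff-shift-+ˡ zero    p k = refl
coeff-shift-+ˡ (suc n) p k = coeff-shift-+ˡ n p k

shift-shift : ∀ m n p → shift m (shift n p) ≡ shift (m + n) p
shift-shift zero    n p = refl
shift-shift (suc m) n p = cong (0 ∷_) (shift-shift m n p)

sq-⊕ : ∀ p q → sq (p ⊕ q) ≡ sq p ⊕ sq q
sq-⊕ []      q       = refl
sq-⊕ (a ∷ p) []      = refl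
sq-⊕ (a ∷ p) (b ∷ q) = cong (λ r → a + b ∷ 0 ∷ r) (sq-⊕ p q)

sq-shift : ∀ n p → sq (shift n p) ≡ shift (double n) (sq p)
sq-shift zero    p = refl
sq-shift (suc n) p = cong (λ r → 0 ∷ 0 ∷ r) (sq-shift n p)

coeff-shift-sq-⊕ : ∀ a p q k → coeff (shift a (sq (p ⊕ q))) k ≡ coeff (shift a (sq p)) k + coeff (shift a (sq q)) k
coeff-shift-sq-⊕ a p q k = trans (cong (λ r → coeff (shift a r) k) (sq-⊕ p q)) (coeff-shift-⊕ a (sq p) (sq q) k)

shift-sq-shift : ∀ a t p → shift a (sq (shift t p)) ≡ shift (double t + a) (sq p)
shift-sq-shift a t p = begin
  shift a (sq (shift t p))          ≡⟨ cong (shift a) (sq-shift t p) ⟩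
  shift a (shift (double t) (sq p)) ≡⟨ shift-shift a (double t) (sq p) ⟩
  shift (a + double t) (sq p)       ≡⟨ cong (λ n → shift n (sq p)) (+-comm a (double t)) ⟩
  shift (double t + a) (sq p)       ∎

coeff-shift-sq-shift : ∀ a t p k → coeff (shift a (sq (shift t p))) k ≡
  (if double t ≤ᵇ k then coeff (shift a (sq p)) (k ∸ double t) else 0)
coeff-shift-sq-shift a t p k =
  trans (cong (λ r → coeff r k) (shift-sq-shift a t p)) (coeff-shift-+ (double t) a (sq p) k)

coeff-shift-suc-sq-shift : ∀ a t p k → coeff (shift (suc a) (sq (shift t p))) k ≡
  (if suc (double t) ≤ᵇ k then coeff (shift a (sq p)) (k ∸ suc (double t)) else 0)
coeff-shift-suc-sq-shift a t p k = begin
  coeff (shift (suc a) (sq (shift t p))) k   ≡⟨ cong (λ r → coeff r k) (shift-sq-shift (suc a) t p) ⟩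
  coeff (shift (double t + suc a) (sq p)) k  ≡⟨ cong (λ n → coeff (shift n (sq p)) k) (+-suc (double t) a) ⟩
  coeff (shift (suc (double t) + a) (sq p)) k ≡⟨ coeff-shift-+ (suc (double t)) a (sq p) k ⟩
  (if suc (double t) ≤ᵇ k then coeff (shift a (sq p)) (k ∸ suc (double t)) else 0) ∎

coeff-oddAux : ∀ a e m k → coeff (shift a (sq (oddAux e m))) k ≡
  ∑[ t < m ] (if double t ≤ᵇ k then coeff (shift a (sq (e (suc t)))) (k ∸ double t) else 0)
coeff-oddAux a e zero    k = coeff-shift-0P a k
coeff-oddAux a e (suc m) k = trans (coeff-shift-sq-⊕ a (oddAux e m) _ k)
  (cong₂ _+_ (coeff-oddAux a e m k) (coeff-shift-sq-shift a m (e (suc m)) k))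

coeff-evenAux : ∀ a i o m k → coeff (shift (suc a) (sq (evenAux i o m))) k ≡
  ∑[ t < m ] (if suc (double (i ∸ t ∸ 1)) ≤ᵇ k then coeff (shift a (sq (o (i ∸ t)))) (k ∸ suc (double (i ∸ t ∸ 1))) else 0)
coeff-evenAux a i o zero    k = coeff-shift-0P (suc a) k
coeff-evenAux a i o (suc m) k = trans (coeff-shift-sq-⊕ (suc a) (evenAux i o m) _ k)
  (cong₂ _+_ (coeff-evenAux a i o m k) (coeff-shift-suc-sq-shift a (i ∸ m ∸ 1) (o (i ∸ m)) k))

-- Words, and codes of permutations

∑-words-∷ : ∀ m N (φ : List ℕ → ℕ) → ∑∈ (words (suc m) N) φ ≡ ∑[ i < N ] ∑[ w ∈ words m N ] φ (suc i ∷ w)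
∑-words-∷ m N φ = begin
  ∑∈ (concat (map (λ a → map (a ∷_) (words m N)) (map suc (upTo N)))) φ
    ≡⟨ ∑∈-concat (map (λ a → map (a ∷_) (words m N)) (map suc (upTo N))) φ ⟩
  ∑[ ws ∈ map (λ a → map (a ∷_) (words m N)) (map suc (upTo N)) ] ∑∈ ws φ
    ≡⟨ ∑∈-map _ (map suc (upTo N)) _ ⟩
  ∑[ a ∈ map suc (upTo N) ] ∑∈ (map (a ∷_) (words m N)) φ
    ≡⟨ ∑∈-map suc (upTo N) _ ⟩
  ∑[ i ∈ upTo N ] ∑∈ (map (suc i ∷_) (words m N)) φ
    ≡⟨ ∑∈-applyUpTo id N _ ⟩
  ∑[ i < N ] ∑∈ (map (suc i ∷_) (words m N)) φ
    ≡⟨ ∑<-cong N (λ i _ → ∑∈-map (suc i ∷_) (words m N) φ) ⟩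
  ∑[ i < N ] ∑[ w ∈ words m N ] φ (suc i ∷ w) ∎

∑-words-∷ʳ : ∀ m N (φ : List ℕ → ℕ) → ∑∈ (words (suc m) N) φ ≡ ∑[ w ∈ words m N ] ∑[ i < N ] φ (w ++ suc i ∷ [])
∑-words-∷ʳ zero    N φ = trans (∑-words-∷ zero N φ) (trans (∑<-cong N (λ i _ → +-identityʳ _)) (sym (+-identityʳ _)))
∑-words-∷ʳ (suc m) N φ = begin
  ∑∈ (words (suc (suc m)) N) φ
    ≡⟨ ∑-words-∷ (suc m) N φ ⟩
  ∑[ a < N ] ∑[ w ∈ words (suc m) N ] φ (suc a ∷ w)
    ≡⟨ ∑<-cong N (λ a _ → ∑-words-∷ʳ m N (λ w → φ (suc a ∷ w))) ⟩
  ∑[ a < N ] ∑[ w ∈ words m N ] ∑[ i < N ] φ (suc a ∷ w ++ suc i ∷ [])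
    ≡⟨ sym (∑-words-∷ m N (λ w → ∑[ i < N ] φ (w ++ suc i ∷ []))) ⟩
  ∑[ w ∈ words (suc m) N ] ∑[ i < N ] φ (w ++ suc i ∷ []) ∎

inRangeᵇ : ℕ → ℕ → Bool
inRangeᵇ N x = (0 <ᵇ x) ∧ (x <ᵇ suc N)

∑-words-cong : ∀ m N {φ ψ : List ℕ → ℕ} →
  (∀ w → length w ≡ m → allᵇ (inRangeᵇ N) w ≡ true → φ w ≡ ψ w) → ∑∈ (words m N) φ ≡ ∑∈ (words m N) ψ
∑-words-cong zero    N eq = cong (_+ 0) (eq [] refl refl)
∑-words-cong (suc m) N {φ} {ψ} eq = begin
  ∑∈ (words (suc m) N) φ                         ≡⟨ ∑-words-∷ m N φ ⟩
  ∑[ i < N ] ∑[ w ∈ words m N ] φ (suc i ∷ w)   ≡⟨ ∑<-cong N (λ i i<N → ∑-words-cong m N (λ w len inR →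
                                                      eq (suc i ∷ w) (cong suc len)
                                                         (trans (cong (_∧ allᵇ (inRangeᵇ N) w) (<ᵇ-true (s≤s i<N))) inR))) ⟩
  ∑[ i < N ] ∑[ w ∈ words m N ] ψ (suc i ∷ w)   ≡⟨ sym (∑-words-∷ m N ψ) ⟩
  ∑∈ (words (suc m) N) ψ                         ∎

punchIn : ℕ → ℕ → ℕ
punchIn v y = if y <ᵇ v then y else suc y

punchIn-< : ∀ {v y} → y < v → punchIn v y ≡ y
punchIn-< y<v rewrite <ᵇ-true y<v = refl

punchIn-≥ : ∀ {v y} → v ≤ y → punchIn v y ≡ suc y
punchIn-≥ v≤y rewrite <ᵇ-false v≤y = refl

punchIn-<ᵇ : ∀ v x y → (punchIn v x <ᵇ punchIn v y) ≡ (x <ᵇ y)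
punchIn-<ᵇ v x y with x <? v | y <? v
... | yes x<v | yes y<v rewrite punchIn-< x<v | punchIn-< y<v = refl
... | yes x<v | no y≮v rewrite punchIn-< x<v | punchIn-≥ (≮⇒≥ y≮v) =
  trans (<ᵇ-true (m<n⇒m<1+n x<y)) (sym (<ᵇ-true x<y))
  where x<y = <-≤-trans x<v (≮⇒≥ y≮v)
... | no x≮v | yes y<v rewrite punchIn-≥ (≮⇒≥ x≮v) | punchIn-< y<v =
  trans (<ᵇ-false (m≤n⇒m≤1+n y≤x)) (sym (<ᵇ-false y≤x))
  where y≤x = ≤-trans (<⇒≤ y<v) (≮⇒≥ x≮v)
... | no x≮v | no y≮v rewrite punchIn-≥ (≮⇒≥ x≮v) | punchIn-≥ (≮⇒≥ y≮v) = refl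

≡ᵇ≡not-<ᵇ∨>ᵇ : ∀ x y → (x ≡ᵇ y) ≡ not ((x <ᵇ y) ∨ (y <ᵇ x))
≡ᵇ≡not-<ᵇ∨>ᵇ zero    zero    = refl
≡ᵇ≡not-<ᵇ∨>ᵇ zero    (suc y) = refl
≡ᵇ≡not-<ᵇ∨>ᵇ (suc x) zero    = refl
≡ᵇ≡not-<ᵇ∨>ᵇ (suc x) (suc y) = ≡ᵇ≡not-<ᵇ∨>ᵇ x y

punchIn-≡ᵇ : ∀ v x y → (punchIn v x ≡ᵇ punchIn v y) ≡ (x ≡ᵇ y)
punchIn-≡ᵇ v x y = begin
  (punchIn v x ≡ᵇ punchIn v y)
    ≡⟨ ≡ᵇ≡not-<ᵇ∨>ᵇ (punchIn v x) (punchIn v y) ⟩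
  not ((punchIn v x <ᵇ punchIn v y) ∨ (punchIn v y <ᵇ punchIn v x))
    ≡⟨ cong₂ (λ a b → not (a ∨ b)) (punchIn-<ᵇ v x y) (punchIn-<ᵇ v y x) ⟩
  not ((x <ᵇ y) ∨ (y <ᵇ x))
    ≡⟨ sym (≡ᵇ≡not-<ᵇ∨>ᵇ x y) ⟩
  (x ≡ᵇ y) ∎

punchIn-≢ : ∀ v y → (v ≡ᵇ punchIn v y) ≡ false
punchIn-≢ v y with y <? v
... | yes y<v rewrite punchIn-< y<v = ≡ᵇ-false (>⇒≢ y<v)
... | no y≮v  rewrite punchIn-≥ (≮⇒≥ y≮v) = ≡ᵇ-false (<⇒≢ (s≤s (≮⇒≥ y≮v)))

∑<-skip : ∀ N {k} → k ≤ N → (X : ℕ → ℕ) →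
  ∑[ a < suc N ] (if k ≡ᵇ a then 0 else X (suc a)) ≡ ∑[ a < N ] X (punchIn (suc k) (suc a))
∑<-skip zero    z≤n X = refl
∑<-skip (suc N) {k} k≤1+N X with k ≤? N
... | yes k≤N rewrite ≡ᵇ-false (<⇒≢ (s≤s k≤N)) | punchIn-≥ (s≤s k≤N) = cong (_+ X (suc (suc N))) (∑<-skip N k≤N X)
... | no k≰N rewrite ≤-antisym k≤1+N (≰⇒> k≰N) | ≡ᵇ-refl (suc N) = begin
  ∑[ a < suc N ] (if suc N ≡ᵇ a then 0 else X (suc a)) + 0
    ≡⟨ +-identityʳ _ ⟩
  ∑[ a < suc N ] (if suc N ≡ᵇ a then 0 else X (suc a))
    ≡⟨ ∑<-cong (suc N) (λ a a<1+N → cong₂ (λ b c → if b then 0 else X c)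
                                          (≡ᵇ-false (>⇒≢ a<1+N)) (sym (punchIn-< (s≤s a<1+N)))) ⟩
  ∑[ a < suc N ] X (punchIn (suc (suc N)) (suc a)) ∎

∑-words-avoiding : ∀ m N {k} → k ≤ N → (φ : List ℕ → ℕ) →
  ∑[ w ∈ words m (suc N) ] (if memberᵇ (suc k) w then 0 else φ w) ≡ ∑[ w ∈ words m N ] φ (map (punchIn (suc k)) w)
∑-words-avoiding zero    N k≤N φ = refl
∑-words-avoiding (suc m) N {k} k≤N φ = begin
  ∑[ w ∈ words (suc m) (suc N) ] (if memberᵇ (suc k) w then 0 else φ w)
    ≡⟨ ∑-words-∷ m (suc N) _ ⟩
  ∑[ a < suc N ] ∑[ w ∈ words m (suc N) ] (if (k ≡ᵇ a) ∨ memberᵇ (suc k) w then 0 else φ (suc a ∷ w))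
    ≡⟨ ∑<-cong (suc N) (λ a _ → avoid-first a) ⟩
  ∑[ a < suc N ] (if k ≡ᵇ a then 0 else X (suc a))
    ≡⟨ ∑<-skip N k≤N X ⟩
  ∑[ a < N ] X (punchIn (suc k) (suc a))
    ≡⟨ sym (∑-words-∷ m N _) ⟩
  ∑[ w ∈ words (suc m) N ] φ (map (punchIn (suc k)) w) ∎
  where
  X : ℕ → ℕ
  X b = ∑[ w ∈ words m N ] φ (b ∷ map (punchIn (suc k)) w)
  avoid-first : ∀ a → ∑[ w ∈ words m (suc N) ] (if (k ≡ᵇ a) ∨ memberᵇ (suc k) w then 0 else φ (suc a ∷ w)) ≡
                      (if k ≡ᵇ a then 0 else X (suc a))
  avoid-first a with k ≡ᵇ a
  ... | true  = ∑∈-0 (words m (suc N))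
  ... | false = ∑-words-avoiding m N k≤N (λ w → φ (suc a ∷ w))

memberᵇ-map : ∀ f → (∀ x y → (f x ≡ᵇ f y) ≡ (x ≡ᵇ y)) → ∀ x ys → memberᵇ (f x) (map f ys) ≡ memberᵇ x ys
memberᵇ-map f f-inj x []       = refl
memberᵇ-map f f-inj x (y ∷ ys) = cong₂ _∨_ (f-inj x y) (memberᵇ-map f f-inj x ys)

distinctᵇ-map : ∀ f → (∀ x y → (f x ≡ᵇ f y) ≡ (x ≡ᵇ y)) → ∀ ys → distinctᵇ (map f ys) ≡ distinctᵇ ys
distinctᵇ-map f f-inj []       = refl
distinctᵇ-map f f-inj (y ∷ ys) = cong₂ (λ a b → not a ∧ b) (memberᵇ-map f f-inj y ys) (distinctᵇ-map f f-inj ys)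

memberᵇ-punchIn : ∀ v ys → memberᵇ v (map (punchIn v) ys) ≡ false
memberᵇ-punchIn v []       = refl
memberᵇ-punchIn v (y ∷ ys) rewrite punchIn-≢ v y = memberᵇ-punchIn v ys

memberᵇ-∷ʳ : ∀ y xs x → memberᵇ y (xs ++ x ∷ []) ≡ memberᵇ y xs ∨ (y ≡ᵇ x)
memberᵇ-∷ʳ y []       x = sym (∨-comm false (y ≡ᵇ x))
memberᵇ-∷ʳ y (z ∷ xs) x = trans (cong ((y ≡ᵇ z) ∨_) (memberᵇ-∷ʳ y xs x)) (sym (∨-assoc (y ≡ᵇ z) _ _))

distinctᵇ-∷ʳ : ∀ xs x → distinctᵇ (xs ++ x ∷ []) ≡ distinctᵇ xs ∧ not (memberᵇ x xs)
distinctᵇ-∷ʳ []       x = refl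
distinctᵇ-∷ʳ (y ∷ xs) x rewrite memberᵇ-∷ʳ y xs x | distinctᵇ-∷ʳ xs x | ≡ᵇ-sym y x =
  shuffle (memberᵇ y xs) (x ≡ᵇ y) (distinctᵇ xs) (memberᵇ x xs)
  where
  shuffle : ∀ a b c d → not (a ∨ b) ∧ (c ∧ not d) ≡ (not a ∧ c) ∧ not (b ∨ d)
  shuffle true  b     c     d = refl
  shuffle false true  c     d = sym (∧-zeroʳ c)
  shuffle false false c     d = refl

data Code : ℕ → List ℕ → Set where
  []  : Code 0 []
  _∷_ : ∀ {N k rc} → k ≤ N → Code N rc → Code (suc N) (k ∷ rc)

decode : List ℕ → List ℕ
decode []       = []
decode (k ∷ rc) = map (punchIn (suc k)) (decode rc) ++ suc k ∷ []

∑codes : ℕ → (List ℕ → ℕ) → ℕ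
∑codes zero    φ = φ []
∑codes (suc N) φ = ∑[ k < suc N ] ∑codes N (λ rc → φ (k ∷ rc))

∑codes-cong : ∀ N {φ ψ : List ℕ → ℕ} → (∀ {rc} → Code N rc → φ rc ≡ ψ rc) → ∑codes N φ ≡ ∑codes N ψ
∑codes-cong zero    eq = eq []
∑codes-cong (suc N) eq = ∑<-cong (suc N) (λ k k<1+N → ∑codes-cong N (λ c → eq (≤-pred k<1+N ∷ c)))

∑codes-0 : ∀ N → ∑codes N (λ _ → 0) ≡ 0
∑codes-0 zero    = refl
∑codes-0 (suc N) = trans (∑<-cong (suc N) (λ k _ → ∑codes-0 N)) (∑<-0 (suc N))

∑codes-if : ∀ N b (φ : List ℕ → ℕ) → ∑codes N (λ rc → if b then φ rc else 0) ≡ (if b then ∑codes N φ else 0)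
∑codes-if N true  φ = refl
∑codes-if N false φ = ∑codes-0 N

distinctᵇ-punchIn-∷ʳ : ∀ v w → distinctᵇ (map (punchIn v) w ++ v ∷ []) ≡ distinctᵇ w
distinctᵇ-punchIn-∷ʳ v w = begin
  distinctᵇ (map (punchIn v) w ++ v ∷ [])
    ≡⟨ distinctᵇ-∷ʳ (map (punchIn v) w) v ⟩
  distinctᵇ (map (punchIn v) w) ∧ not (memberᵇ v (map (punchIn v) w))
    ≡⟨ cong₂ (λ a b → a ∧ not b) (distinctᵇ-map (punchIn v) (punchIn-≡ᵇ v) w) (memberᵇ-punchIn v w) ⟩
  distinctᵇ w ∧ true
    ≡⟨ ∧-identityʳ _ ⟩
  distinctᵇ w ∎

distinctᵇ-decode : ∀ rc → distinctᵇ (decode rc) ≡ true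
distinctᵇ-decode []       = refl
distinctᵇ-decode (k ∷ rc) = trans (distinctᵇ-punchIn-∷ʳ (suc k) (decode rc)) (distinctᵇ-decode rc)

∑-distinct-words : ∀ N (φ : List ℕ → ℕ) →
  ∑[ σ ∈ words N N ] (if distinctᵇ σ then φ σ else 0) ≡ ∑codes N (φ ∘ decode)
∑-distinct-words zero    φ = +-identityʳ _
∑-distinct-words (suc N) φ = begin
  ∑[ σ ∈ words (suc N) (suc N) ] φ′ σ
    ≡⟨ ∑-words-∷ʳ N (suc N) φ′ ⟩
  ∑[ w ∈ words N (suc N) ] ∑[ i < suc N ] φ′ (w ++ suc i ∷ [])
    ≡⟨ ∑∈-∑<-comm (words N (suc N)) (suc N) (λ w i → φ′ (w ++ suc i ∷ [])) ⟩
  ∑[ i < suc N ] ∑[ w ∈ words N (suc N) ] φ′ (w ++ suc i ∷ [])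
    ≡⟨ ∑<-cong (suc N) (λ i i<1+N → last-value i (≤-pred i<1+N)) ⟩
  ∑codes (suc N) (φ ∘ decode) ∎
  where
  φ′ : List ℕ → ℕ
  φ′ σ = if distinctᵇ σ then φ σ else 0
  split : ∀ a b (x : ℕ) → (if a ∧ not b then x else 0) ≡ (if b then 0 else (if a then x else 0))
  split a true  x rewrite ∧-zeroʳ a     = refl
  split a false x rewrite ∧-identityʳ a = refl
  last-value : ∀ i → i ≤ N → ∑[ w ∈ words N (suc N) ] φ′ (w ++ suc i ∷ []) ≡ ∑codes N (λ rc → φ (decode (i ∷ rc)))
  last-value i i≤N = begin
    ∑[ w ∈ words N (suc N) ] φ′ (w ++ suc i ∷ [])
      ≡⟨ ∑∈-cong (words N (suc N)) (λ w → trans (cong (λ b → if b then φ (w ++ suc i ∷ []) else 0) (distinctᵇ-∷ʳ w (suc i)))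
                                                  (split (distinctᵇ w) (memberᵇ (suc i) w) _)) ⟩
    ∑[ w ∈ words N (suc N) ] (if memberᵇ (suc i) w then 0 else ψ w)
      ≡⟨ ∑-words-avoiding N N i≤N ψ ⟩
    ∑[ w ∈ words N N ] ψ (map (punchIn (suc i)) w)
      ≡⟨ ∑∈-cong (words N N) (λ w → cong (λ b → if b then φ (map (punchIn (suc i)) w ++ suc i ∷ []) else 0)
                                        (distinctᵇ-map (punchIn (suc i)) (punchIn-≡ᵇ (suc i)) w)) ⟩
    ∑[ w ∈ words N N ] (if distinctᵇ w then φ (map (punchIn (suc i)) w ++ suc i ∷ []) else 0)
      ≡⟨ ∑-distinct-words N (λ w → φ (map (punchIn (suc i)) w ++ suc i ∷ [])) ⟩
    ∑codes N (λ rc → φ (decode (i ∷ rc))) ∎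
    where
    ψ : List ℕ → ℕ
    ψ w = if distinctᵇ w then φ (w ++ suc i ∷ []) else 0

-- Inversion statistics of decoded codes

module _ (p : ℕ → Bool) where

  countᵇ-++ : ∀ xs ys → countᵇ p (xs ++ ys) ≡ countᵇ p xs + countᵇ p ys
  countᵇ-++ []       ys = refl
  countᵇ-++ (x ∷ xs) ys with p x
  ... | true  = cong suc (countᵇ-++ xs ys)
  ... | false = countᵇ-++ xs ys

  countᵇ-∷ʳ : ∀ xs x → countᵇ p (xs ++ x ∷ []) ≡ countᵇ p xs + 𝟙 (p x)
  countᵇ-∷ʳ xs x = trans (countᵇ-++ xs (x ∷ [])) (cong (countᵇ p xs +_) singleton)
    where
    singleton : countᵇ p (x ∷ []) ≡ 𝟙 (p x)
    singleton with p x
    ... | true  = refl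
    ... | false = refl

  countᵇ-map : ∀ (f : ℕ → ℕ) xs → countᵇ p (map f xs) ≡ countᵇ (p ∘ f) xs
  countᵇ-map f []       = refl
  countᵇ-map f (x ∷ xs) with p (f x)
  ... | true  = cong suc (countᵇ-map f xs)
  ... | false = countᵇ-map f xs

  countᵇ-+-not : ∀ xs → countᵇ p xs + countᵇ (not ∘ p) xs ≡ length xs
  countᵇ-+-not []       = refl
  countᵇ-+-not (x ∷ xs) with p x
  ... | true  = cong suc (countᵇ-+-not xs)
  ... | false = trans (+-suc (countᵇ p xs) _) (cong suc (countᵇ-+-not xs))

countᵇ-cong : ∀ {p q} xs → (∀ y → p y ≡ q y) → countᵇ p xs ≡ countᵇ q xs
countᵇ-cong           []       eq = refl
countᵇ-cong {p} {q} (x ∷ xs) eq rewrite eq x with q x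
... | true  = cong suc (countᵇ-cong xs eq)
... | false = countᵇ-cong xs eq

countᵇ-mono : ∀ {p q} xs → (∀ y → p y ≡ true → q y ≡ true) → countᵇ p xs ≤ countᵇ q xs
countᵇ-mono           []       imp = z≤n
countᵇ-mono {p} {q} (x ∷ xs) imp with p x in px
... | true  rewrite imp x px = s≤s (countᵇ-mono xs imp)
... | false with q x
...   | true  = m≤n⇒m≤1+n (countᵇ-mono xs imp)
...   | false = countᵇ-mono xs imp

<ᵇ-suc≡not->ᵇ : ∀ a b → (a <ᵇ suc b) ≡ not (b <ᵇ a)
<ᵇ-suc≡not->ᵇ zero    b       = refl
<ᵇ-suc≡not->ᵇ (suc a) zero    = refl
<ᵇ-suc≡not->ᵇ (suc a) (suc b) = <ᵇ-suc≡not->ᵇ a b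

punchIn-≤ᵇ-below : ∀ {k m} → m ≤ k → ∀ y → (punchIn (suc k) y <ᵇ suc m) ≡ (y <ᵇ suc m)
punchIn-≤ᵇ-below {k} {m} m≤k y = begin
  (punchIn (suc k) y <ᵇ suc m)                   ≡⟨ <ᵇ-suc≡not->ᵇ (punchIn (suc k) y) m ⟩
  not (m <ᵇ punchIn (suc k) y)                   ≡⟨ cong (λ z → not (z <ᵇ punchIn (suc k) y)) (sym (punchIn-< (s≤s m≤k))) ⟩
  not (punchIn (suc k) m <ᵇ punchIn (suc k) y)   ≡⟨ cong not (punchIn-<ᵇ (suc k) m y) ⟩
  not (m <ᵇ y)                                   ≡⟨ sym (<ᵇ-suc≡not->ᵇ y m) ⟩
  (y <ᵇ suc m)                                   ∎

punchIn-≤ᵇ-above : ∀ {k m} → k ≤ m → ∀ y → (punchIn (suc k) y <ᵇ suc (suc m)) ≡ (y <ᵇ suc m)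
punchIn-≤ᵇ-above {k} {m} k≤m y =
  trans (cong (punchIn (suc k) y <ᵇ_) (sym (punchIn-≥ (s≤s k≤m)))) (punchIn-<ᵇ (suc k) y (suc m))

length-decode : ∀ rc → length (decode rc) ≡ length rc
length-decode []       = refl
length-decode (k ∷ rc) = begin
  length (map (punchIn (suc k)) (decode rc) ++ suc k ∷ []) ≡⟨ length-++ (map (punchIn (suc k)) (decode rc)) ⟩
  length (map (punchIn (suc k)) (decode rc)) + 1           ≡⟨ cong (_+ 1) (trans (length-map _ (decode rc)) (length-decode rc)) ⟩
  length rc + 1                                            ≡⟨ +-comm (length rc) 1 ⟩
  suc (length rc)                                          ∎

Code-length : ∀ {N rc} → Code N rc → length rc ≡ N
Code-length []      = refl
Code-length (_ ∷ c) = cong suc (Code-length c)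

-- decode rc is a permutation of 1..N, so exactly m of its entries are at most m.
countᵇ-≤-decode : ∀ {N rc} → Code N rc → ∀ {m} → m ≤ N → countᵇ (_<ᵇ suc m) (decode rc) ≡ m
countᵇ-≤-decode []                  z≤n = refl
countᵇ-≤-decode {suc N} {k ∷ rc} (k≤N ∷ c) {m} m≤1+N = begin
  countᵇ (_<ᵇ suc m) (map L (decode rc) ++ suc k ∷ [])
    ≡⟨ countᵇ-∷ʳ (_<ᵇ suc m) (map L (decode rc)) (suc k) ⟩
  countᵇ (_<ᵇ suc m) (map L (decode rc)) + 𝟙 (k <ᵇ m)
    ≡⟨ cong (_+ 𝟙 (k <ᵇ m)) (countᵇ-map (_<ᵇ suc m) L (decode rc)) ⟩
  countᵇ (λ y → L y <ᵇ suc m) (decode rc) + 𝟙 (k <ᵇ m)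
    ≡⟨ by-cases m m≤1+N (k <? m) ⟩
  m ∎
  where
  L = punchIn (suc k)
  by-cases : ∀ m → m ≤ suc N → Dec (k < m) → countᵇ (λ y → L y <ᵇ suc m) (decode rc) + 𝟙 (k <ᵇ m) ≡ m
  by-cases (suc m) (s≤s m≤N) (yes (s≤s k≤m)) rewrite <ᵇ-true (s≤s k≤m) = begin
    countᵇ (λ y → L y <ᵇ suc (suc m)) (decode rc) + 1 ≡⟨ cong (_+ 1) (countᵇ-cong (decode rc) (punchIn-≤ᵇ-above k≤m)) ⟩
    countᵇ (_<ᵇ suc m) (decode rc) + 1                ≡⟨ cong (_+ 1) (countᵇ-≤-decode c m≤N) ⟩
    m + 1                                             ≡⟨ +-comm m 1 ⟩
    suc m                                             ∎
  by-cases m _ (no k≮m) rewrite <ᵇ-false (≮⇒≥ k≮m) = begin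
    countᵇ (λ y → L y <ᵇ suc m) (decode rc) + 0 ≡⟨ +-identityʳ _ ⟩
    countᵇ (λ y → L y <ᵇ suc m) (decode rc)     ≡⟨ countᵇ-cong (decode rc) (punchIn-≤ᵇ-below (≮⇒≥ k≮m)) ⟩
    countᵇ (_<ᵇ suc m) (decode rc)              ≡⟨ countᵇ-≤-decode c (≤-trans (≮⇒≥ k≮m) k≤N) ⟩
    m                                           ∎

invTableAux-∷ʳ : ∀ pre xs x → invTableAux pre (xs ++ x ∷ []) ≡ invTableAux pre xs ++ countᵇ (_<ᵇ x) (pre ++ xs) ∷ []
invTableAux-∷ʳ pre []       x = cong (λ l → countᵇ (_<ᵇ x) l ∷ []) (sym (++-identityʳ pre))
invTableAux-∷ʳ pre (y ∷ xs) x = cong (countᵇ (_<ᵇ y) pre ∷_) (begin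
  invTableAux (pre ++ y ∷ []) (xs ++ x ∷ [])
    ≡⟨ invTableAux-∷ʳ (pre ++ y ∷ []) xs x ⟩
  invTableAux (pre ++ y ∷ []) xs ++ countᵇ (_<ᵇ x) ((pre ++ y ∷ []) ++ xs) ∷ []
    ≡⟨ cong (λ l → invTableAux (pre ++ y ∷ []) xs ++ countᵇ (_<ᵇ x) l ∷ []) (++-assoc pre (y ∷ []) xs) ⟩
  invTableAux (pre ++ y ∷ []) xs ++ countᵇ (_<ᵇ x) (pre ++ y ∷ xs) ∷ [] ∎)

invAux-∷ʳ : ∀ pre xs x → invAux pre (xs ++ x ∷ []) ≡ invAux pre xs + countᵇ (x <ᵇ_) (pre ++ xs)
invAux-∷ʳ pre []       x = trans (+-identityʳ _) (cong (countᵇ (x <ᵇ_)) (sym (++-identityʳ pre)))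
invAux-∷ʳ pre (y ∷ xs) x = begin
  countᵇ (y <ᵇ_) pre + invAux (pre ++ y ∷ []) (xs ++ x ∷ [])
    ≡⟨ cong (countᵇ (y <ᵇ_) pre +_) (invAux-∷ʳ (pre ++ y ∷ []) xs x) ⟩
  countᵇ (y <ᵇ_) pre + (invAux (pre ++ y ∷ []) xs + countᵇ (x <ᵇ_) ((pre ++ y ∷ []) ++ xs))
    ≡⟨ sym (+-assoc (countᵇ (y <ᵇ_) pre) _ _) ⟩
  countᵇ (y <ᵇ_) pre + invAux (pre ++ y ∷ []) xs + countᵇ (x <ᵇ_) ((pre ++ y ∷ []) ++ xs)
    ≡⟨ cong (λ l → countᵇ (y <ᵇ_) pre + invAux (pre ++ y ∷ []) xs + countᵇ (x <ᵇ_) l) (++-assoc pre (y ∷ []) xs) ⟩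
  countᵇ (y <ᵇ_) pre + invAux (pre ++ y ∷ []) xs + countᵇ (x <ᵇ_) (pre ++ y ∷ xs) ∎

module _ (f : ℕ → ℕ) (f-<ᵇ : ∀ a b → (f a <ᵇ f b) ≡ (a <ᵇ b)) where

  invTableAux-map : ∀ pre xs → invTableAux (map f pre) (map f xs) ≡ invTableAux pre xs
  invTableAux-map pre []       = refl
  invTableAux-map pre (y ∷ xs) = cong₂ _∷_
    (trans (countᵇ-map (_<ᵇ f y) f pre) (countᵇ-cong pre (λ a → f-<ᵇ a y)))
    (trans (cong (λ l → invTableAux l (map f xs)) (sym (map-++ f pre (y ∷ [])))) (invTableAux-map (pre ++ y ∷ []) xs))

  invAux-map : ∀ pre xs → invAux (map f pre) (map f xs) ≡ invAux pre xs
  invAux-map pre []       = refl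
  invAux-map pre (y ∷ xs) = cong₂ _+_
    (trans (countᵇ-map (f y <ᵇ_) f pre) (countᵇ-cong pre (f-<ᵇ y)))
    (trans (cong (λ l → invAux l (map f xs)) (sym (map-++ f pre (y ∷ [])))) (invAux-map (pre ++ y ∷ []) xs))

invTable-decode-∷ : ∀ {N k rc} → Code (suc N) (k ∷ rc) → invTable (decode (k ∷ rc)) ≡ invTable (decode rc) ++ k ∷ []
invTable-decode-∷ {N} {k} {rc} (k≤N ∷ c) = begin
  invTableAux [] (map L (decode rc) ++ suc k ∷ [])
    ≡⟨ invTableAux-∷ʳ [] (map L (decode rc)) (suc k) ⟩
  invTableAux [] (map L (decode rc)) ++ countᵇ (_<ᵇ suc k) (map L (decode rc)) ∷ []
    ≡⟨ cong₂ (λ t n → t ++ n ∷ []) (invTableAux-map L (punchIn-<ᵇ (suc k)) [] (decode rc)) smaller ⟩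
  invTable (decode rc) ++ k ∷ [] ∎
  where
  L = punchIn (suc k)
  smaller : countᵇ (_<ᵇ suc k) (map L (decode rc)) ≡ k
  smaller = trans (countᵇ-map (_<ᵇ suc k) L (decode rc))
                  (trans (countᵇ-cong (decode rc) (punchIn-≤ᵇ-below ≤-refl)) (countᵇ-≤-decode c k≤N))

invCode : List ℕ → ℕ
invCode []       = 0
invCode (k ∷ rc) = invCode rc + (length rc ∸ k)

inv-decode : ∀ {N rc} → Code N rc → inv (decode rc) ≡ invCode rc
inv-decode []                        = refl
inv-decode {suc N} {k ∷ rc} (k≤N ∷ c) = begin
  invAux [] (map L (decode rc) ++ suc k ∷ [])
    ≡⟨ invAux-∷ʳ [] (map L (decode rc)) (suc k) ⟩
  invAux [] (map L (decode rc)) + countᵇ (suc k <ᵇ_) (map L (decode rc))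
    ≡⟨ cong₂ _+_ (trans (invAux-map L (punchIn-<ᵇ (suc k)) [] (decode rc)) (inv-decode c)) larger ⟩
  invCode rc + (length rc ∸ k) ∎
  where
  L = punchIn (suc k)
  larger : countᵇ (suc k <ᵇ_) (map L (decode rc)) ≡ length rc ∸ k
  larger = begin
    countᵇ (suc k <ᵇ_) (map L (decode rc))
      ≡⟨ countᵇ-map (suc k <ᵇ_) L (decode rc) ⟩
    countᵇ (λ y → suc k <ᵇ L y) (decode rc)
      ≡⟨ countᵇ-cong (decode rc) (λ y → trans (sym (not-involutive _))
           (cong not (trans (sym (<ᵇ-suc≡not->ᵇ (L y) (suc k))) (punchIn-≤ᵇ-above ≤-refl y)))) ⟩
    countᵇ (not ∘ (_<ᵇ suc k)) (decode rc)
      ≡⟨ sym (m+n∸m≡n k _) ⟩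
    k + countᵇ (not ∘ (_<ᵇ suc k)) (decode rc) ∸ k
      ≡⟨ cong (λ z → z + countᵇ (not ∘ (_<ᵇ suc k)) (decode rc) ∸ k) (sym (countᵇ-≤-decode c k≤N)) ⟩
    countᵇ (_<ᵇ suc k) (decode rc) + countᵇ (not ∘ (_<ᵇ suc k)) (decode rc) ∸ k
      ≡⟨ cong (_∸ k) (trans (countᵇ-+-not (_<ᵇ suc k) (decode rc)) (length-decode rc)) ⟩
    length rc ∸ k ∎

-- Alternation read on the inversion table

wordStep : Bool → ℕ → ℕ → Bool
wordStep true  a b = b <ᵇ a
wordStep false a b = a <ᵇ b

tableStep : Bool → ℕ → ℕ → Bool
tableStep true  c c′ = c′ ≤ᵇ c
tableStep false c c′ = c <ᵇ c′

zigzag : (Bool → ℕ → ℕ → Bool) → Bool → ℕ → List ℕ → Bool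
zigzag step d x []       = true
zigzag step d x (y ∷ ys) = step d x y ∧ zigzag step (not d) y ys

zigzagTable : List ℕ → Bool
zigzagTable []       = true
zigzagTable (c ∷ cs) = zigzag tableStep true c cs

alternatingᵇ≡zigzag : ∀ n x ys → length ys ≡ double n → alternatingᵇ (x ∷ ys) ≡ zigzag wordStep true x ys
alternatingᵇ≡zigzag zero    x []           _   = refl
alternatingᵇ≡zigzag (suc n) x (y ∷ z ∷ ys) len =
  cong (λ b → (y <ᵇ x) ∧ (y <ᵇ z) ∧ b) (alternatingᵇ≡zigzag n z ys (suc-injective (suc-injective len)))

module _ (x y : ℕ) (pre : List ℕ) where

  private
    before-y : countᵇ (_<ᵇ y) (pre ++ x ∷ []) ≡ countᵇ (_<ᵇ y) pre + 𝟙 (x <ᵇ y)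
    before-y = countᵇ-∷ʳ (_<ᵇ y) pre x

  invTable-increases : x < y → countᵇ (_<ᵇ x) pre < countᵇ (_<ᵇ y) (pre ++ x ∷ [])
  invTable-increases x<y rewrite before-y | <ᵇ-true x<y | +-comm (countᵇ (_<ᵇ y) pre) 1 =
    s≤s (countᵇ-mono pre (λ z z<x → <ᵇ-true (<-trans (<ᵇ⇒< z x (≡true⇒T z<x)) x<y)))

  invTable-weakly-decreases : y < x → countᵇ (_<ᵇ y) (pre ++ x ∷ []) ≤ countᵇ (_<ᵇ x) pre
  invTable-weakly-decreases y<x rewrite before-y | <ᵇ-false (<⇒≤ y<x) | +-identityʳ (countᵇ (_<ᵇ y) pre) =
    countᵇ-mono pre (λ z z<y → <ᵇ-true (<-trans (<ᵇ⇒< z y (≡true⇒T z<y)) y<x))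

  wordStep≡tableStep : ∀ d → x ≢ y → wordStep d x y ≡ tableStep d (countᵇ (_<ᵇ x) pre) (countᵇ (_<ᵇ y) (pre ++ x ∷ []))
  wordStep≡tableStep d x≢y with <-cmp x y
  wordStep≡tableStep true  x≢y | tri< x<y _ _ = trans (<ᵇ-false (<⇒≤ x<y)) (sym (≤ᵇ-false (invTable-increases x<y)))
  wordStep≡tableStep false x≢y | tri< x<y _ _ = trans (<ᵇ-true x<y) (sym (<ᵇ-true (invTable-increases x<y)))
  wordStep≡tableStep d     x≢y | tri≈ _ x≡y _ = ⊥-elim (x≢y x≡y)
  wordStep≡tableStep true  x≢y | tri> _ _ y<x = trans (<ᵇ-true y<x) (sym (≤ᵇ-true (invTable-weakly-decreases y<x)))
  wordStep≡tableStep false x≢y | tri> _ _ y<x = trans (<ᵇ-false (<⇒≤ y<x)) (sym (<ᵇ-false (invTable-weakly-decreases y<x)))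

zigzag-invTable : ∀ d pre x ys → distinctᵇ (x ∷ ys) ≡ true →
  zigzag wordStep d x ys ≡ zigzag tableStep d (countᵇ (_<ᵇ x) pre) (invTableAux (pre ++ x ∷ []) ys)
zigzag-invTable d pre x []       _        = refl
zigzag-invTable d pre x (y ∷ ys) distinct with x ≡ᵇ y in x≡ᵇy
zigzag-invTable d pre x (y ∷ ys) () | true
... | false = cong₂ _∧_ (wordStep≡tableStep x y pre d (λ x≡y → subst T x≡ᵇy (≡⇒≡ᵇ x y x≡y)))
                        (zigzag-invTable (not d) (pre ++ x ∷ []) y ys (∧-true {not (memberᵇ x ys)} distinct))
  where ∧-true : ∀ {a b} → a ∧ b ≡ true → b ≡ true
        ∧-true {true} ab = ab

notⁿ : ℕ → Bool → Bool
notⁿ zero    d = d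
notⁿ (suc n) d = notⁿ n (not d)

zigzag-∷ʳ : ∀ step d x ys a b →
  zigzag step d x (ys ++ a ∷ b ∷ []) ≡ zigzag step d x (ys ++ a ∷ []) ∧ step (notⁿ (suc (length ys)) d) a b
zigzag-∷ʳ step d x []       a b = trans (cong (step d x a ∧_) (∧-identityʳ _)) (cong (_∧ step (not d) a b) (sym (∧-identityʳ _)))
zigzag-∷ʳ step d x (y ∷ ys) a b = trans (cong (step d x y ∧_) (zigzag-∷ʳ step (not d) y ys a b))
                                        (sym (∧-assoc (step d x y) _ _))

zigzagTable-∷ʳ : ∀ cs a b →
  zigzagTable ((cs ++ a ∷ []) ++ b ∷ []) ≡ zigzagTable (cs ++ a ∷ []) ∧ tableStep (notⁿ (length cs) true) a b
zigzagTable-∷ʳ []       a b = ∧-identityʳ _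
zigzagTable-∷ʳ (c ∷ cs) a b rewrite ++-assoc cs (a ∷ []) (b ∷ []) = zigzag-∷ʳ tableStep true c cs a b

allᵇ-∷ʳ : ∀ p xs x → allᵇ p (xs ++ x ∷ []) ≡ allᵇ p xs ∧ p x
allᵇ-∷ʳ p []       x = ∧-identityʳ (p x)
allᵇ-∷ʳ p (y ∷ xs) x = trans (cong (p y ∧_) (allᵇ-∷ʳ p xs x)) (sym (∧-assoc (p y) _ _))

length-invTableAux : ∀ pre xs → length (invTableAux pre xs) ≡ length xs
length-invTableAux pre []       = refl
length-invTableAux pre (x ∷ xs) = cong suc (length-invTableAux (pre ++ x ∷ []) xs)

-- With m = length rc, k′ = f(m+1) and k = f(m+2); the step σ(m+1), σ(m+2) must be a descent iff m is even.
validᵇ : List ℕ → Bool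
validᵇ []            = true
validᵇ (k ∷ [])      = evenᵇ k
validᵇ (k ∷ k′ ∷ rc) = evenᵇ k ∧ tableStep (notⁿ (length rc) true) k′ k ∧ validᵇ (k′ ∷ rc)

evenZigzagᵇ : List ℕ → Bool
evenZigzagᵇ cs = allᵇ evenᵇ cs ∧ zigzagTable cs

evenZigzagᵇ-∷ʳ : ∀ cs a b → evenZigzagᵇ ((cs ++ a ∷ []) ++ b ∷ []) ≡
  evenᵇ b ∧ tableStep (notⁿ (length cs) true) a b ∧ evenZigzagᵇ (cs ++ a ∷ [])
evenZigzagᵇ-∷ʳ cs a b = begin
  allᵇ evenᵇ ((cs ++ a ∷ []) ++ b ∷ []) ∧ zigzagTable ((cs ++ a ∷ []) ++ b ∷ [])
    ≡⟨ cong₂ _∧_ (allᵇ-∷ʳ evenᵇ (cs ++ a ∷ []) b) (zigzagTable-∷ʳ cs a b) ⟩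
  (allᵇ evenᵇ (cs ++ a ∷ []) ∧ evenᵇ b) ∧ (zigzagTable (cs ++ a ∷ []) ∧ tableStep (notⁿ (length cs) true) a b)
    ≡⟨ ∧-interchange (allᵇ evenᵇ (cs ++ a ∷ [])) (evenᵇ b) (zigzagTable (cs ++ a ∷ [])) _ ⟩
  evenZigzagᵇ (cs ++ a ∷ []) ∧ (evenᵇ b ∧ tableStep (notⁿ (length cs) true) a b)
    ≡⟨ ∧-comm (evenZigzagᵇ (cs ++ a ∷ [])) _ ⟩
  (evenᵇ b ∧ tableStep (notⁿ (length cs) true) a b) ∧ evenZigzagᵇ (cs ++ a ∷ [])
    ≡⟨ ∧-assoc (evenᵇ b) _ _ ⟩
  evenᵇ b ∧ tableStep (notⁿ (length cs) true) a b ∧ evenZigzagᵇ (cs ++ a ∷ []) ∎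

evenZigzagᵇ-decode : ∀ {N rc} → Code N rc → evenZigzagᵇ (invTable (decode rc)) ≡ validᵇ rc
evenZigzagᵇ-decode []                  = refl
evenZigzagᵇ-decode (z≤n ∷ [])          = refl
evenZigzagᵇ-decode {rc = k ∷ k′ ∷ rc} c@(_ ∷ c′@(_ ∷ _)) = begin
  evenZigzagᵇ (invTable (decode (k ∷ k′ ∷ rc)))
    ≡⟨ cong evenZigzagᵇ (trans (invTable-decode-∷ c) (cong (_++ k ∷ []) (invTable-decode-∷ c′))) ⟩
  evenZigzagᵇ ((cs ++ k′ ∷ []) ++ k ∷ [])
    ≡⟨ evenZigzagᵇ-∷ʳ cs k′ k ⟩
  evenᵇ k ∧ tableStep (notⁿ (length cs) true) k′ k ∧ evenZigzagᵇ (cs ++ k′ ∷ [])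
    ≡⟨ cong₂ (λ n b → evenᵇ k ∧ tableStep (notⁿ n true) k′ k ∧ b)
             (trans (length-invTableAux [] (decode rc)) (length-decode rc))
             (trans (cong evenZigzagᵇ (sym (invTable-decode-∷ c′))) (evenZigzagᵇ-decode c′)) ⟩
  validᵇ (k ∷ k′ ∷ rc) ∎
  where cs = invTable (decode rc)

alternatingᵇ≡zigzagTable : ∀ n σ → distinctᵇ σ ≡ true → length σ ≡ suc (double n) →
  alternatingᵇ σ ≡ zigzagTable (invTable σ)
alternatingᵇ≡zigzagTable n (x ∷ ys) distinct len =
  trans (alternatingᵇ≡zigzag n x ys (suc-injective len)) (zigzag-invTable true [] x ys distinct)

alternating-even≡validᵇ : ∀ {n rc} → Code (suc (double n)) rc →
  alternatingᵇ (decode rc) ∧ allᵇ evenᵇ (invTable (decode rc)) ≡ validᵇ rc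
alternating-even≡validᵇ {n} {rc} c = begin
  alternatingᵇ (decode rc) ∧ allᵇ evenᵇ (invTable (decode rc))
    ≡⟨ cong (_∧ allᵇ evenᵇ (invTable (decode rc)))
         (alternatingᵇ≡zigzagTable n (decode rc) (distinctᵇ-decode rc) (trans (length-decode rc) (Code-length c))) ⟩
  zigzagTable (invTable (decode rc)) ∧ allᵇ evenᵇ (invTable (decode rc))
    ≡⟨ ∧-comm (zigzagTable (invTable (decode rc))) _ ⟩
  evenZigzagᵇ (invTable (decode rc))
    ≡⟨ evenZigzagᵇ-decode c ⟩
  validᵇ rc ∎

-- Valid codes counted by their head

evenᵇ-double : ∀ n → evenᵇ (double n) ≡ true
evenᵇ-double zero    = refl
evenᵇ-double (suc n) = evenᵇ-double n

evenᵇ-suc-double : ∀ n → evenᵇ (suc (double n)) ≡ false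
evenᵇ-suc-double zero    = refl
evenᵇ-suc-double (suc n) = evenᵇ-suc-double n

∑<-evens : ∀ m (f : ℕ → ℕ) → ∑[ c < double m ] (if evenᵇ c then f c else 0) ≡ ∑[ h < m ] f (double h)
∑<-evens zero    f = refl
∑<-evens (suc m) f = begin
  ∑< (double m) f′ + f′ (double m) + f′ (suc (double m))
    ≡⟨ cong₂ (λ a b → ∑< (double m) f′ + a + b) (cong (λ b → if b then f (double m) else 0) (evenᵇ-double m))
                                                 (cong (λ b → if b then f (suc (double m)) else 0) (evenᵇ-suc-double m)) ⟩
  ∑< (double m) f′ + f (double m) + 0
    ≡⟨ trans (+-identityʳ _) (cong (_+ f (double m)) (∑<-evens m f)) ⟩
  ∑[ h < m ] f (double h) + f (double m) ∎
  where
  f′ : ℕ → ℕ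
  f′ c = if evenᵇ c then f c else 0

∑<-evens-suc : ∀ m (f : ℕ → ℕ) → ∑[ c < suc (double m) ] (if evenᵇ c then f c else 0) ≡ ∑[ h < suc m ] f (double h)
∑<-evens-suc m f = cong₂ _+_ (∑<-evens m f) (cong (λ b → if b then f (double m) else 0) (evenᵇ-double m))

double-≤ᵇ : ∀ a b → (double a ≤ᵇ double b) ≡ (a ≤ᵇ b)
double-≤ᵇ zero    b       = refl
double-≤ᵇ (suc a) zero    = refl
double-≤ᵇ (suc a) (suc b) = trans (sym (≤ᵇ≡<ᵇ-suc (double a) (double b))) (trans (double-≤ᵇ a b) (≤ᵇ≡<ᵇ-suc a b))

double-<ᵇ : ∀ a b → (double a <ᵇ double b) ≡ (a <ᵇ b)
double-<ᵇ zero    zero    = refl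
double-<ᵇ zero    (suc b) = refl
double-<ᵇ (suc a) zero    = refl
double-<ᵇ (suc a) (suc b) = double-<ᵇ a b

double-∸ : ∀ a b → double (a ∸ b) ≡ double a ∸ double b
double-∸ a       zero    = refl
double-∸ zero    (suc b) = refl
double-∸ (suc a) (suc b) = double-∸ a b

double-mono-≤ : ∀ {a b} → a ≤ b → double a ≤ double b
double-mono-≤ z≤n       = z≤n
double-mono-≤ (s≤s a≤b) = s≤s (s≤s (double-mono-≤ a≤b))

∸-≤ᵇ-∸ : ∀ n a {b} → b ≤ n → (n ∸ a ≤ᵇ n ∸ b) ≡ (b ≤ᵇ a)
∸-≤ᵇ-∸ n a {b} b≤n with b ≤? a
... | yes b≤a = trans (≤ᵇ-true (∸-monoʳ-≤ n b≤a)) (sym (≤ᵇ-true b≤a))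
... | no b≰a  = trans (≤ᵇ-false (∸-monoʳ-< (≰⇒> b≰a) b≤n)) (sym (≤ᵇ-false (≰⇒> b≰a)))

evenᵇ-gap : ∀ {a b} → evenᵇ a ≡ true → evenᵇ b ≡ true → a < b → suc a < b
evenᵇ-gap {zero}        {suc zero}    _  ()  _
evenᵇ-gap {zero}        {suc (suc b)} _  _   _               = s≤s (s≤s z≤n)
evenᵇ-gap {suc (suc a)} {suc (suc b)} ea eb (s≤s (s≤s a<b)) = s≤s (s≤s (evenᵇ-gap ea eb a<b))

notⁿ-double : ∀ n d → notⁿ (double n) d ≡ d
notⁿ-double zero    d = refl
notⁿ-double (suc n) d = trans (notⁿ-double n (not (not d))) (not-involutive d)

head₀ : List ℕ → ℕ
head₀ []      = 0
head₀ (k ∷ _) = k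

validᵇ-∷-ascent : ∀ {m c rc} → Code (double (suc m)) rc → validᵇ (c ∷ rc) ≡ evenᵇ c ∧ (head₀ rc <ᵇ c) ∧ validᵇ rc
validᵇ-∷-ascent {m} {c} (_ ∷ c′) rewrite Code-length c′ | notⁿ-double m false = refl

validᵇ-∷-descent : ∀ {m c rc} → Code (suc (double m)) rc → validᵇ (c ∷ rc) ≡ evenᵇ c ∧ (c ≤ᵇ head₀ rc) ∧ validᵇ rc
validᵇ-∷-descent {m} {c} (_ ∷ c′) rewrite Code-length c′ | notⁿ-double m true = refl

countValid : ℕ → (ℕ → Bool) → ℕ → ℕ
countValid N P K = ∑codes N (λ rc → if validᵇ rc ∧ P (head₀ rc) then 𝟙 (invCode rc ≡ᵇ K) else 0)

countValid-by-head : ∀ N (P : ℕ → Bool) (R : ℕ → ℕ → Bool) K →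
  (∀ {c rc} → Code N rc → validᵇ (c ∷ rc) ≡ evenᵇ c ∧ R c (head₀ rc) ∧ validᵇ rc) →
  countValid (suc N) P K ≡
  ∑[ c < suc N ] (if evenᵇ c then (if P c then (if N ∸ c ≤ᵇ K then countValid N (R c) (K ∸ (N ∸ c)) else 0) else 0) else 0)
countValid-by-head N P R K validᵇ-∷ = ∑<-cong (suc N) (λ c _ → with-head c)
  where
  float : ∀ e r v p d (x : ℕ) →
    (if (e ∧ r ∧ v) ∧ p then (if d then x else 0) else 0) ≡
    (if e then (if p then (if d then (if v ∧ r then x else 0) else 0) else 0) else 0)
  float false r v p     d     x = refl
  float true  r v false d     x rewrite ∧-zeroʳ (r ∧ v) = refl
  float true  r v true  false x rewrite ∧-identityʳ (r ∧ v) with r ∧ v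
  ... | true  = refl
  ... | false = refl
  float true  r v true  true  x rewrite ∧-identityʳ (r ∧ v) | ∧-comm r v = refl

  with-head : ∀ c →
    ∑codes N (λ rc → if validᵇ (c ∷ rc) ∧ P c then 𝟙 (invCode rc + (length rc ∸ c) ≡ᵇ K) else 0) ≡
    (if evenᵇ c then (if P c then (if N ∸ c ≤ᵇ K then countValid N (R c) (K ∸ (N ∸ c)) else 0) else 0) else 0)
  with-head c = begin
    ∑codes N (λ rc → if validᵇ (c ∷ rc) ∧ P c then 𝟙 (invCode rc + (length rc ∸ c) ≡ᵇ K) else 0)
      ≡⟨ ∑codes-cong N (λ {rc} code → trans
           (cong₂ (λ v n → if v ∧ P c then 𝟙 (invCode rc + (n ∸ c) ≡ᵇ K) else 0) (validᵇ-∷ code) (Code-length code))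
           (trans (cong (if (evenᵇ c ∧ R c (head₀ rc) ∧ validᵇ rc) ∧ P c then_else 0) (+-≡ᵇ-split (invCode rc) (N ∸ c) K))
                  (float (evenᵇ c) (R c (head₀ rc)) (validᵇ rc) (P c) (N ∸ c ≤ᵇ K) _))) ⟩
    ∑codes N (λ rc → if evenᵇ c then (if P c then (if N ∸ c ≤ᵇ K then Y rc else 0) else 0) else 0)
      ≡⟨ ∑codes-if N (evenᵇ c) _ ⟩
    (if evenᵇ c then ∑codes N (λ rc → if P c then (if N ∸ c ≤ᵇ K then Y rc else 0) else 0) else 0)
      ≡⟨ cong (if evenᵇ c then_else 0) (trans (∑codes-if N (P c) _) (cong (if P c then_else 0) (∑codes-if N (N ∸ c ≤ᵇ K) Y))) ⟩
    (if evenᵇ c then (if P c then (if N ∸ c ≤ᵇ K then countValid N (R c) (K ∸ (N ∸ c)) else 0) else 0) else 0) ∎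
    where
    Y : List ℕ → ℕ
    Y rc = if validᵇ rc ∧ R c (head₀ rc) then 𝟙 (invCode rc ≡ᵇ K ∸ (N ∸ c)) else 0

-- The q-Seidel triangle

OddRowCounts : ℕ → Set
OddRowCounts i = ∀ j K → j ≤ i →
  coeff (shift i (sq (oddRow i (suc j)))) K ≡ countValid (suc (double i)) (double (i ∸ j) ≤ᵇ_) K

EvenRowCounts : ℕ → Set
EvenRowCounts i = ∀ j K → j ≤ suc i →
  coeff (shift (suc i) (sq (evenRow (suc i) (suc j)))) K ≡ countValid (double (suc i)) (_<ᵇ double (suc i ∸ j)) K

countValid-none : ∀ N K → countValid N (λ _ → false) K ≡ 0
countValid-none N K =
  trans (∑codes-cong N (λ {rc} _ → cong (if_then 𝟙 (invCode rc ≡ᵇ K) else 0) (∧-zeroʳ (validᵇ rc)))) (∑codes-0 N)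

oddRowCounts-0 : OddRowCounts 0
oddRowCounts-0 zero zero          z≤n = refl
oddRowCounts-0 zero (suc zero)    z≤n = refl
oddRowCounts-0 zero (suc (suc K)) z≤n = refl

evenRowCounts-0 : EvenRowCounts 0
evenRowCounts-0 zero       zero                z≤n = refl
evenRowCounts-0 zero       (suc zero)          z≤n = refl
evenRowCounts-0 zero       (suc (suc zero))    z≤n = refl
evenRowCounts-0 zero       (suc (suc (suc K))) z≤n = refl
evenRowCounts-0 (suc zero) K                   (s≤s z≤n) = trans (coeff-shift-0P 1 K) (sym (countValid-none 2 K))

-- The t-th term of row 2i+3 corresponds to the new head c = 2(i+1−t), which adds 2t inversions.
oddRowCounts-step : ∀ i → EvenRowCounts i → OddRowCounts (suc i)
oddRowCounts-step i even-row j K j≤1+i rewrite <ᵇ-true (s≤s j≤1+i) = begin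
  coeff (shift (suc i) (sq (oddAux E (suc j)))) K
    ≡⟨ coeff-oddAux (suc i) E (suc j) K ⟩
  ∑[ t < suc j ] (if double t ≤ᵇ K then coeff (shift (suc i) (sq (E (suc t)))) (K ∸ double t) else 0)
    ≡⟨ ∑<-cong (suc j) (λ t t≤j → cong (if double t ≤ᵇ K then_else 0)
                                         (even-row t (K ∸ double t) (≤-trans (≤-pred t≤j) j≤1+i))) ⟩
  ∑< (suc j) G
    ≡⟨ sym (∑<-restrict (suc (suc i)) G (s≤s j≤1+i)) ⟩
  ∑[ t < suc (suc i) ] (if t <ᵇ suc j then G t else 0)
    ≡⟨ ∑<-cong (suc (suc i)) (λ t t<2+i → reflect t (≤-pred t<2+i)) ⟩
  ∑[ t < suc (suc i) ] Φ (double (suc i ∸ t))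
    ≡⟨ sym (∑<-reverse (suc (suc i)) (Φ ∘ double)) ⟩
  ∑[ h < suc (suc i) ] Φ (double h)
    ≡⟨ sym (∑<-evens-suc (suc i) Φ) ⟩
  ∑[ c < suc (double (suc i)) ] (if evenᵇ c then Φ c else 0)
    ≡⟨ sym (countValid-by-head (double (suc i)) (double (suc i ∸ j) ≤ᵇ_) (λ c h → h <ᵇ c) K validᵇ-∷-ascent) ⟩
  countValid (suc (double (suc i))) (double (suc i ∸ j) ≤ᵇ_) K ∎
  where
  E = evenRow (suc i)
  G : ℕ → ℕ
  G t = if double t ≤ᵇ K then countValid (double (suc i)) (_<ᵇ double (suc i ∸ t)) (K ∸ double t) else 0
  Φ : ℕ → ℕ
  Φ c = if double (suc i ∸ j) ≤ᵇ c
        then (if double (suc i) ∸ c ≤ᵇ K then countValid (double (suc i)) (_<ᵇ c) (K ∸ (double (suc i) ∸ c)) else 0)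
        else 0
  reflect : ∀ t → t ≤ suc i → (if t <ᵇ suc j then G t else 0) ≡ Φ (double (suc i ∸ t))
  reflect t t≤1+i = sym (cong₂
    (λ b d → if b then (if d ≤ᵇ K then countValid (double (suc i)) (_<ᵇ double (suc i ∸ t)) (K ∸ d) else 0) else 0)
    (trans (double-≤ᵇ (suc i ∸ j) (suc i ∸ t)) (trans (∸-≤ᵇ-∸ (suc i) j t≤1+i) (≤ᵇ≡<ᵇ-suc t j)))
    (trans (sym (double-∸ (suc i) (suc i ∸ t))) (cong double (m∸[m∸n]≡n t≤1+i))))

evenRowCounts-step : ∀ i → OddRowCounts (suc i) → EvenRowCounts (suc i)
evenRowCounts-step i odd-row j K j≤2+i with j <? suc (suc i)
... | yes j<2+i rewrite <ᵇ-true j<2+i = begin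
  coeff (shift (suc (suc i)) (sq (evenAux (suc (suc i)) O M))) K
    ≡⟨ coeff-evenAux (suc i) (suc (suc i)) O M K ⟩
  ∑[ t < M ] (if suc (double (suc (suc i) ∸ t ∸ 1)) ≤ᵇ K
              then coeff (shift (suc i) (sq (O (suc (suc i) ∸ t)))) (K ∸ suc (double (suc (suc i) ∸ t ∸ 1))) else 0)
    ≡⟨ ∑<-cong M (λ t t<M → by-odd-row t (≤-pred (≤-trans t<M (m∸n≤m (suc (suc i)) j)))) ⟩
  ∑[ t < M ] H (double t)
    ≡⟨ sym (∑<-restrict (suc (suc i)) (H ∘ double) (m∸n≤m (suc (suc i)) j)) ⟩
  ∑[ h < suc (suc i) ] (if h <ᵇ M then H (double h) else 0)
    ≡⟨ ∑<-cong (suc (suc i)) (λ h _ → cong (if_then H (double h) else 0) (sym (double-<ᵇ h M))) ⟩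
  ∑[ h < suc (suc i) ] (if double h <ᵇ double M then H (double h) else 0)
    ≡⟨ sym (∑<-evens (suc (suc i)) (λ c → if c <ᵇ double M then H c else 0)) ⟩
  ∑[ c < double (suc (suc i)) ] (if evenᵇ c then (if c <ᵇ double M then H c else 0) else 0)
    ≡⟨ sym (countValid-by-head (suc (double (suc i))) (_<ᵇ double M) (λ c h → c ≤ᵇ h) K validᵇ-∷-descent) ⟩
  countValid (double (suc (suc i))) (_<ᵇ double M) K ∎
  where
  O = oddRow (suc i)
  M = suc (suc i) ∸ j
  H : ℕ → ℕ
  H c = if suc (double (suc i)) ∸ c ≤ᵇ K then countValid (suc (double (suc i))) (c ≤ᵇ_) (K ∸ (suc (double (suc i)) ∸ c)) else 0
  by-odd-row : ∀ t → t ≤ suc i →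
    (if suc (double (suc (suc i) ∸ t ∸ 1)) ≤ᵇ K
     then coeff (shift (suc i) (sq (O (suc (suc i) ∸ t)))) (K ∸ suc (double (suc (suc i) ∸ t ∸ 1))) else 0) ≡ H (double t)
  by-odd-row t t≤1+i rewrite +-∸-assoc 1 t≤1+i =
    cong₂ (λ d n → if d ≤ᵇ K then n else 0) gap
      (trans (odd-row (suc i ∸ t) (K ∸ suc (double (suc i ∸ t))) (m∸n≤m (suc i) t))
             (cong₂ (λ b d → countValid (suc (double (suc i))) (b ≤ᵇ_) (K ∸ d)) (cong double (m∸[m∸n]≡n t≤1+i)) gap))
    where
    gap : suc (double (suc i ∸ t)) ≡ suc (double (suc i)) ∸ double t
    gap = trans (cong suc (double-∸ (suc i) t)) (sym (+-∸-assoc 1 (double-mono-≤ t≤1+i)))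
... | no j≮2+i rewrite ≤-antisym j≤2+i (≮⇒≥ j≮2+i) | <ᵇ-false (≤-refl {suc (suc i)}) | n∸n≡0 (suc (suc i)) =
  trans (coeff-shift-0P (suc (suc i)) K) (sym (countValid-none (double (suc (suc i))) K))

oddRowCounts : ∀ i → OddRowCounts i
evenRowCounts : ∀ i → EvenRowCounts i
oddRowCounts zero     = oddRowCounts-0
oddRowCounts (suc i)  = oddRowCounts-step i (evenRowCounts i)
evenRowCounts zero    = evenRowCounts-0
evenRowCounts (suc i) = evenRowCounts-step i (oddRowCounts (suc i))

∧-conjuncts : ∀ {a b c} → a ∧ b ∧ c ≡ true → a ≡ true × b ≡ true × c ≡ true
∧-conjuncts {true} {true} {true} refl = refl , refl , refl

ascent-gap : ∀ {n k k′ rc} → Code (suc (double (suc n))) (k ∷ k′ ∷ rc) → validᵇ (k ∷ k′ ∷ rc) ≡ true →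
  suc k′ < k × validᵇ rc ≡ true
ascent-gap {k = k} {k′} (_ ∷ c′@(_ ∷ c″)) valid
  with ∧-conjuncts (trans (sym (validᵇ-∷-ascent {c = k} c′)) valid)
... | even-k , k′<ᵇk , valid′ with ∧-conjuncts (trans (sym (validᵇ-∷-descent {c = k′} c″)) valid′)
... | even-k′ , _ , valid-rc = evenᵇ-gap even-k′ even-k (<ᵇ⇒< k′ k (≡true⇒T k′<ᵇk)) , valid-rc

n≤invCode : ∀ n {rc} → Code (suc (double n)) rc → validᵇ rc ≡ true → n ≤ invCode rc
n≤invCode zero    _ _ = z≤n
n≤invCode (suc n) {k ∷ k′ ∷ rc} c@(k≤ ∷ _ ∷ c″) valid with ascent-gap c valid
... | 1+k′<k , valid-rc = ≤-trans (s≤s (n≤invCode n c″ valid-rc)) (≤-trans one-more (m≤m+n _ _))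
  where
  k′<length : k′ < length rc
  k′<length = subst (k′ <_) (sym (Code-length c″)) (≤-pred (≤-trans 1+k′<k k≤))
  one-more : suc (invCode rc) ≤ invCode rc + (length rc ∸ k′)
  one-more = subst (_≤ invCode rc + (length rc ∸ k′)) (+-comm (invCode rc) 1) (+-monoʳ-≤ (invCode rc) (m<n⇒0<n∸m k′<length))

∸-≡ᵇ : ∀ {n x} k → n ≤ x → (x ∸ n ≡ᵇ k) ≡ (x ≡ᵇ n + k)
∸-≡ᵇ {n} {x} k n≤x = trans (sym (+-≡ᵇ-cancelˡ n (x ∸ n) k)) (cong (_≡ᵇ n + k) (m+[n∸m]≡n n≤x))

2*≡double : ∀ n → 2 * n ≡ double n
2*≡double zero    = refl
2*≡double (suc n) = cong suc (trans (+-suc n (n + 0)) (cong suc (2*≡double n)))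

coeff-genF : ∀ n K → coeff (genF n) K ≡ countValid (suc (double n)) (λ _ → true) (n + K)
coeff-genF n K = begin
  coeff (genF n) K
    ≡⟨ coeff-∑⊕ (λ σ → mono (inv σ ∸ n)) (F n) K ⟩
  ∑[ σ ∈ F n ] coeff (mono (inv σ ∸ n)) K
    ≡⟨ ∑∈-cong (F n) (λ σ → coeff-mono (inv σ ∸ n) K) ⟩
  ∑[ σ ∈ F n ] 𝟙 (inv σ ∸ n ≡ᵇ K)
    ≡⟨ ∑∈-filterᵇ inF (words N N) _ ⟩
  ∑[ σ ∈ words N N ] (if inF σ then 𝟙 (inv σ ∸ n ≡ᵇ K) else 0)
    ≡⟨ ∑-words-cong N N (λ w len in-range → permutation-by-distinct w len in-range) ⟩
  ∑[ σ ∈ words N N ] (if distinctᵇ σ then Ψ σ else 0)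
    ≡⟨ cong (λ N → ∑[ σ ∈ words (suc N) (suc N) ] (if distinctᵇ σ then Ψ σ else 0)) (2*≡double n) ⟩
  ∑[ σ ∈ words (suc (double n)) (suc (double n)) ] (if distinctᵇ σ then Ψ σ else 0)
    ≡⟨ ∑-distinct-words (suc (double n)) Ψ ⟩
  ∑codes (suc (double n)) (Ψ ∘ decode)
    ≡⟨ ∑codes-cong (suc (double n)) Ψ-decode ⟩
  countValid (suc (double n)) (λ _ → true) (n + K) ∎
  where
  N = suc (2 * n)
  inF : List ℕ → Bool
  inF σ = isPermᵇ N σ ∧ alternatingᵇ σ ∧ allᵇ evenᵇ (invTable σ)
  Ψ : List ℕ → ℕ
  Ψ σ = if alternatingᵇ σ ∧ allᵇ evenᵇ (invTable σ) then 𝟙 (inv σ ∸ n ≡ᵇ K) else 0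
  permutation-by-distinct : ∀ w → length w ≡ N → allᵇ (inRangeᵇ N) w ≡ true →
    (if inF w then 𝟙 (inv w ∸ n ≡ᵇ K) else 0) ≡ (if distinctᵇ w then Ψ w else 0)
  permutation-by-distinct w len in-range rewrite len | ≡ᵇ-refl N | in-range with distinctᵇ w
  ... | true  = refl
  ... | false = refl
  Ψ-decode : ∀ {rc} → Code (suc (double n)) rc → Ψ (decode rc) ≡ (if validᵇ rc ∧ true then 𝟙 (invCode rc ≡ᵇ n + K) else 0)
  Ψ-decode {rc} c rewrite alternating-even≡validᵇ c | inv-decode c | ∧-identityʳ (validᵇ rc) with validᵇ rc in valid
  ... | true  = cong 𝟙 (∸-≡ᵇ K (n≤invCode n c valid))
  ... | false = refl

[1+2n]%2≡1 : ∀ n → suc (double n) % 2 ≡ 1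
[1+2n]%2≡1 zero    = refl
[1+2n]%2≡1 (suc n) = [1+2n]%2≡1 n

[1+2n]/2≡n : ∀ n → suc (double n) / 2 ≡ n
[1+2n]/2≡n zero    = refl
[1+2n]/2≡n (suc n) = trans (m/n≡1+[m∸n]/n {suc (suc (suc (double n)))} (s≤s (s≤s z≤n))) (cong suc ([1+2n]/2≡n n))

g-odd : ∀ n → g (suc (double n)) ≡ oddRow n
g-odd n rewrite [1+2n]%2≡1 n | [1+2n]/2≡n n = refl

qGenocchi≡oddRow : ∀ m → qGenocchi (suc (suc m)) ≡ oddRow (suc m) (suc (suc m))
qGenocchi≡oddRow m = cong (λ row → row (suc (suc m))) (trans (cong (λ r → g (r ∸ 1)) (2*≡double (suc (suc m)))) (g-odd (suc m)))

proposition4 : (n : ℕ) → 1 ≤ n → (k : ℕ) →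
    coeff (sq (qGenocchi (suc n))) k ≡ coeff (genF n) k
proposition4 (suc m) _ k = begin
  coeff (sq (qGenocchi (suc (suc m)))) k
    ≡⟨ cong (λ p → coeff (sq p) k) (qGenocchi≡oddRow m) ⟩
  coeff (sq (oddRow (suc m) (suc (suc m)))) k
    ≡⟨ sym (coeff-shift-+ˡ (suc m) (sq (oddRow (suc m) (suc (suc m)))) k) ⟩
  coeff (shift (suc m) (sq (oddRow (suc m) (suc (suc m))))) (suc m + k)
    ≡⟨ oddRowCounts (suc m) (suc m) (suc m + k) ≤-refl ⟩
  countValid (suc (double (suc m))) (double (m ∸ m) ≤ᵇ_) (suc m + k)
    ≡⟨ cong (λ b → countValid (suc (double (suc m))) (double b ≤ᵇ_) (suc m + k)) (n∸n≡0 m) ⟩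
  countValid (suc (double (suc m))) (λ _ → true) (suc m + k)
    ≡⟨ sym (coeff-genF (suc m) k) ⟩
  coeff (genF (suc m)) k ∎
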